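{- Let $\gamma\geq 2$ be an integer and $\Gamma=\mathbb{Z}_{4}\oplus \mathbb{Z}_{2^{2\gamma}}$. Then there exists a $\Gamma$-magic square $\mathrm{MS}_{\Gamma}(2^{\gamma+1})$ of side $2^{\gamma+1}$.
   Context: For an Abelian group $(\Gamma,+)$ of order $n^2$, a $\Gamma$-magic square $\mathrm{MS}_{\Gamma}(n)$ (of side $n$) is an $n\times n$ array whose entries are all the elements of $\Gamma$ (each element appearing exactly once) such that all row sums, all column sums, the sum along the main diagonal and the sum along the backward main diagonal are equal to the same element $\mu\in\Gamma$. $\mathbb{Z}_r$ denotes the cyclic group of order $r$. -}

module Defs where

open import Data.Nat using (ℕ; zero; suc; _^_; _*_; NonZero)
open import Data.Nat.DivMod using (_mod_)
open import Data.Fin using (Fin; toℕ; opposite)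
import Data.Nat as ℕ
open import Data.Product using (_×_; _,_; uncurry)
open import Relation.Binary.PropositionalEquality using (_≡_)
open import Function.Bundles using (Bijection)
import Relation.Binary.PropositionalEquality as P

ℤ : ℕ → Set
ℤ r = Fin r

addℤ : (r : ℕ) .{{_ : NonZero r}} → ℤ r → ℤ r → ℤ r
addℤ r a b = (toℕ a ℕ.+ toℕ b) mod r

zeroℤ : (r : ℕ) .{{_ : NonZero r}} → ℤ r
zeroℤ r = 0 mod r

Γ : ℕ → Set
Γ γ = ℤ 4 × ℤ (2 ^ (2 * γ))

nz2^ : ∀ k → NonZero (2 ^ k)
nz2^ k = ℕ.>-nonZero (Data.Nat.Properties.m^n>0 2 k)
  where import Data.Nat.Properties

⊕ : ∀ γ → Γ γ → Γ γ → Γ γ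
⊕ γ (a , b) (c , d) = addℤ 4 a c , addℤ (2 ^ (2 * γ)) {{nz2^ (2 * γ)}} b d

𝟘 : ∀ γ → Γ γ
𝟘 γ = zeroℤ 4 , zeroℤ (2 ^ (2 * γ)) {{nz2^ (2 * γ)}}

sumΓ : ∀ γ n → (Fin n → Γ γ) → Γ γ
sumΓ γ zero f = 𝟘 γ
sumΓ γ (suc n) f = ⊕ γ (f Fin.zero) (sumΓ γ n (λ i → f (Fin.suc i)))
  where import Data.Fin as Fin

record MagicSquare (γ n : ℕ) : Set where
  field
    M         : Fin n → Fin n → Γ γ
    bij       : Bijection (P.setoid (Fin n × Fin n)) (P.setoid (Γ γ))
    bij-is-M  : ∀ p → Bijection.to bij p ≡ uncurry M p
    μ         : Γ γ
    rows      : ∀ i → sumΓ γ n (λ j → M i j) ≡ μ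
    cols      : ∀ j → sumΓ γ n (λ i → M i j) ≡ μ
    diag      : sumΓ γ n (λ i → M i i) ≡ μ
    antidiag  : sumΓ γ n (λ i → M i (opposite i)) ≡ μ

-- Write k = 2^γ and split the square of side 2k into four k × k blocks.  The block in block-row r
-- and block-column s carries the ℤ₄-component 2r + s; its ℤ_{k²}-component at position (a, b)
-- is k b + a, with a reflected to k − 1 − a in the right block-column.  The ℤ₄-component names
-- the block and the base-k digits name the position, so every element occurs exactly once.
-- Every row, column and diagonal meets exactly two blocks in k cells each, so its ℤ₄-sum is a
-- multiple of k, hence 0 because 4 ∣ k; by the Gauss sum 2 (0 + 1 + ⋯ + (k − 1)) = k (k − 1)
-- its ℤ_{k²}-sum is k (k − 1) plus a multiple of k².
module Submission where

open import Defs
open import Data.Nat using (ℕ; _≤_; _^_; _+_; _*_; _∸_; _%_; _/_; NonZero; zero; suc; s≤s)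
import Data.Nat.Properties as ℕ
open import Data.Nat.DivMod using (_mod_; m≡m%n+[m/n]*n; [m+kn]%n≡m%n)
open import Data.Nat.Divisibility using (_∣_; ∣-trans; m∣m*n; n∣m⇒m%n≡0)
open import Data.Nat.Tactic.RingSolver using (solve-∀)
open import Data.Fin as Fin
  using (Fin; toℕ; opposite; splitAt; join; _↑ˡ_; _↑ʳ_; cast; combine; remQuot)
open import Data.Fin.Patterns using (0F; 1F; 2F; 3F)
open import Data.Fin.Properties
  using ( fromℕ<-cong; toℕ-fromℕ<; toℕ-injective; toℕ<n; toℕ≤pred[n]; toℕ-↑ˡ; toℕ-↑ʳ
        ; opposite-prop; opposite-involutive; toℕ-cast; cast-involutive; toℕ-combine
        ; remQuot-combine; combine-remQuot; splitAt-join; join-splitAt; +↔⊎)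
open import Data.Fin.Permutation using (reverse)
open import Data.Product using (_×_; _,_; proj₁; proj₂; uncurry)
open import Data.Product.Function.NonDependent.Propositional using (_×-↔_)
open import Data.Sum using (_⊎_; inj₁; inj₂; swap; map₁) renaming (map to ⊎-map)
open import Function using (id; const; _∘_; _$_; _↔_; mk↔ₛ′)
open import Function.Construct.Composition using (_↔-∘_)
open import Function.Properties.Inverse using (↔⇒⤖)
open import Relation.Binary.PropositionalEquality
open import Algebra.Properties.Semiring.Sum ℕ.+-*-semiring
  using (sum-syntax; ∑-distrib-+; ∑-permute; sum-cong-≗; *-distribˡ-sum)

open ≡-Reasoning

∑-const : ∀ n c → ∑[ i < n ] c ≡ n * c
∑-const zero    c = refl
∑-const (suc n) c = cong (c +_) (∑-const n c)

∑-opposite : ∀ n (f : Fin n → ℕ) → ∑[ i < n ] f (opposite i) ≡ ∑[ i < n ] f i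
∑-opposite n f = sym (∑-permute f reverse)

∑-splitAt : ∀ m {n} (h : Fin m ⊎ Fin n → ℕ) →
            ∑[ i < m + n ] h (splitAt m i) ≡ ∑[ a < m ] h (inj₁ a) + ∑[ b < n ] h (inj₂ b)
∑-splitAt zero    h = refl
∑-splitAt (suc m) h = trans (cong (h (inj₁ 0F) +_) (∑-splitAt m (h ∘ map₁ Fin.suc)))
                            (sym (ℕ.+-assoc (h (inj₁ 0F)) _ _))

toℕ+toℕ-opposite : ∀ {n} (i : Fin n) → toℕ i + toℕ (opposite i) ≡ n ∸ 1
toℕ+toℕ-opposite {suc n} i = trans (cong (toℕ i +_) (opposite-prop i)) (ℕ.m+[n∸m]≡n (toℕ≤pred[n] i))

∑-toℕ+∑-toℕ-opposite : ∀ n → ∑[ i < n ] toℕ i + ∑[ i < n ] toℕ (opposite i) ≡ n * (n ∸ 1)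
∑-toℕ+∑-toℕ-opposite n = begin
  ∑[ i < n ] toℕ i + ∑[ i < n ] toℕ (opposite i) ≡⟨ ∑-distrib-+ {n} toℕ (toℕ ∘ opposite) ⟨
  ∑[ i < n ] (toℕ i + toℕ (opposite i))          ≡⟨ sum-cong-≗ {n} toℕ+toℕ-opposite ⟩
  ∑[ i < n ] (n ∸ 1)                             ≡⟨ ∑-const n (n ∸ 1) ⟩
  n * (n ∸ 1)                                    ∎

2*∑-toℕ : ∀ n → 2 * ∑[ i < n ] toℕ i ≡ n * (n ∸ 1)
2*∑-toℕ n = begin
  2 * ∑[ i < n ] toℕ i                           ≡⟨ cong (∑[ i < n ] toℕ i +_) (ℕ.+-identityʳ _) ⟩
  ∑[ i < n ] toℕ i + ∑[ i < n ] toℕ i            ≡⟨ cong (∑[ i < n ] toℕ i +_) (∑-opposite n toℕ) ⟨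
  ∑[ i < n ] toℕ i + ∑[ i < n ] toℕ (opposite i) ≡⟨ ∑-toℕ+∑-toℕ-opposite n ⟩
  n * (n ∸ 1)                                    ∎

opposite-join : ∀ n (x : Fin n ⊎ Fin n) →
                opposite (join n n x) ≡ join n n (swap (⊎-map opposite opposite x))
opposite-join n (inj₁ i) = toℕ-injective (begin
  toℕ (opposite (i ↑ˡ n))        ≡⟨ opposite-prop (i ↑ˡ n) ⟩
  (n + n) ∸ suc (toℕ (i ↑ˡ n))   ≡⟨ cong (λ z → (n + n) ∸ suc z) (toℕ-↑ˡ i n) ⟩
  (n + n) ∸ suc (toℕ i)          ≡⟨ ℕ.+-∸-assoc n (toℕ<n i) ⟩
  n + (n ∸ suc (toℕ i))          ≡⟨ cong (n +_) (opposite-prop i) ⟨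
  n + toℕ (opposite i)           ≡⟨ toℕ-↑ʳ n (opposite i) ⟨
  toℕ (n ↑ʳ opposite i)          ∎)
opposite-join n (inj₂ i) = toℕ-injective (begin
  toℕ (opposite (n ↑ʳ i))        ≡⟨ opposite-prop (n ↑ʳ i) ⟩
  (n + n) ∸ suc (toℕ (n ↑ʳ i))   ≡⟨ cong (λ z → (n + n) ∸ suc z) (toℕ-↑ʳ n i) ⟩
  (n + n) ∸ suc (n + toℕ i)      ≡⟨ cong ((n + n) ∸_) (ℕ.+-suc n (toℕ i)) ⟨
  (n + n) ∸ (n + suc (toℕ i))    ≡⟨ ℕ.[m+n]∸[m+o]≡n∸o n n (suc (toℕ i)) ⟩
  n ∸ suc (toℕ i)                ≡⟨ opposite-prop i ⟨
  toℕ (opposite i)               ≡⟨ toℕ-↑ˡ (opposite i) n ⟨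
  toℕ (opposite i ↑ˡ n)          ∎)

splitAt-opposite : ∀ n (i : Fin (n + n)) →
                   splitAt n (opposite i) ≡ swap (⊎-map opposite opposite (splitAt n i))
splitAt-opposite n i = begin
  splitAt n (opposite i)                                            ≡⟨ cong (splitAt n ∘ opposite) (join-splitAt n n i) ⟨
  splitAt n (opposite (join n n (splitAt n i)))                     ≡⟨ cong (splitAt n) (opposite-join n (splitAt n i)) ⟩
  splitAt n (join n n (swap (⊎-map opposite opposite (splitAt n i)))) ≡⟨ splitAt-join n n _ ⟩
  swap (⊎-map opposite opposite (splitAt n i))                      ∎

mod-cong : ∀ d .{{_ : NonZero d}} x y → x % d ≡ y % d → x mod d ≡ y mod d
mod-cong d x y x%d≡y%d = fromℕ<-cong _ _ x%d≡y%d _ _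

+-toℕ-mod : ∀ d .{{_ : NonZero d}} a S → (a + toℕ (S mod d)) mod d ≡ (a + S) mod d
+-toℕ-mod d a S = mod-cong d _ _ (begin
  (a + toℕ (S mod d)) % d         ≡⟨ cong (λ r → (a + r) % d) (toℕ-fromℕ< _) ⟩
  (a + S % d) % d                 ≡⟨ [m+kn]%n≡m%n (a + S % d) (S / d) d ⟨
  (a + S % d + S / d * d) % d     ≡⟨ cong (_% d) (ℕ.+-assoc a _ _) ⟩
  (a + (S % d + S / d * d)) % d   ≡⟨ cong (λ r → (a + r) % d) (m≡m%n+[m/n]*n S d) ⟨
  (a + S) % d                     ∎)

module _ (γ : ℕ) where

  private instance
    nonZero-order : NonZero (2 ^ (2 * γ))
    nonZero-order = nz2^ (2 * γ)

  sumΓ-cong : ∀ n {f g : Fin n → Γ γ} → (∀ i → f i ≡ g i) → sumΓ γ n f ≡ sumΓ γ n g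
  sumΓ-cong zero    f≗g = refl
  sumΓ-cong (suc n) f≗g = cong₂ (⊕ γ) (f≗g 0F) (sumΓ-cong n (f≗g ∘ Fin.suc))

  sumΓ-mod : ∀ n (f : Fin n → Γ γ) →
             sumΓ γ n f ≡ ( ∑[ i < n ] toℕ (proj₁ (f i)) mod 4
                          , ∑[ i < n ] toℕ (proj₂ (f i)) mod 2 ^ (2 * γ))
  sumΓ-mod zero    f = refl
  sumΓ-mod (suc n) f rewrite sumΓ-mod n (f ∘ Fin.suc) =
    cong₂ _,_ (+-toℕ-mod 4 (toℕ (proj₁ (f 0F))) _) (+-toℕ-mod (2 ^ (2 * γ)) (toℕ (proj₂ (f 0F))) _)

  module Construction (k : ℕ) (2^[2γ]≡k*k : 2 ^ (2 * γ) ≡ k * k) (4∣k : 4 ∣ k) where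

    fromDigits : Fin k → Fin k → Fin (2 ^ (2 * γ))
    fromDigits b y = cast (sym 2^[2γ]≡k*k) (combine b y)

    toℕ-fromDigits : ∀ b y → toℕ (fromDigits b y) ≡ k * toℕ b + toℕ y
    toℕ-fromDigits b y = trans (toℕ-cast (sym 2^[2γ]≡k*k) (combine b y)) (toℕ-combine b y)

    remQuot-fromDigits : ∀ b y → remQuot k (cast 2^[2γ]≡k*k (fromDigits b y)) ≡ (b , y)
    remQuot-fromDigits b y =
      trans (cong (remQuot k) (cast-involutive 2^[2γ]≡k*k (sym 2^[2γ]≡k*k) (combine b y)))
            (remQuot-combine b y)

    fromDigits-remQuot : ∀ v → uncurry fromDigits (remQuot k (cast 2^[2γ]≡k*k v)) ≡ v
    fromDigits-remQuot v =
      trans (cong (cast (sym 2^[2γ]≡k*k)) (combine-remQuot {k} k (cast 2^[2γ]≡k*k v)))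
            (cast-involutive (sym 2^[2γ]≡k*k) 2^[2γ]≡k*k v)

    entry : Fin k ⊎ Fin k → Fin k ⊎ Fin k → Γ γ
    entry (inj₁ a) (inj₁ b) = 0F , fromDigits b a
    entry (inj₁ a) (inj₂ b) = 1F , fromDigits b (opposite a)
    entry (inj₂ a) (inj₁ b) = 2F , fromDigits b a
    entry (inj₂ a) (inj₂ b) = 3F , fromDigits b (opposite a)

    positionAt : Fin 4 → Fin k × Fin k → (Fin k ⊎ Fin k) × (Fin k ⊎ Fin k)
    positionAt 0F (b , y) = inj₁ y , inj₁ b
    positionAt 1F (b , y) = inj₁ (opposite y) , inj₂ b
    positionAt 2F (b , y) = inj₂ y , inj₁ b
    positionAt 3F (b , y) = inj₂ (opposite y) , inj₂ b

    position : Γ γ → (Fin k ⊎ Fin k) × (Fin k ⊎ Fin k)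
    position (u , v) = positionAt u (remQuot k (cast 2^[2γ]≡k*k v))

    position-entry : ∀ x y → position (entry x y) ≡ (x , y)
    position-entry (inj₁ a) (inj₁ b) = cong (positionAt 0F) (remQuot-fromDigits b a)
    position-entry (inj₁ a) (inj₂ b) = trans (cong (positionAt 1F) (remQuot-fromDigits b (opposite a)))
                                             (cong (λ z → inj₁ z , inj₂ b) (opposite-involutive a))
    position-entry (inj₂ a) (inj₁ b) = cong (positionAt 2F) (remQuot-fromDigits b a)
    position-entry (inj₂ a) (inj₂ b) = trans (cong (positionAt 3F) (remQuot-fromDigits b (opposite a)))
                                             (cong (λ z → inj₂ z , inj₂ b) (opposite-involutive a))

    entry-positionAt : ∀ u b y → uncurry entry (positionAt u (b , y)) ≡ (u , fromDigits b y)
    entry-positionAt 0F b y = refl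
    entry-positionAt 1F b y = cong (λ z → 1F , fromDigits b z) (opposite-involutive y)
    entry-positionAt 2F b y = refl
    entry-positionAt 3F b y = cong (λ z → 3F , fromDigits b z) (opposite-involutive y)

    entry-position : ∀ g → uncurry entry (position g) ≡ g
    entry-position (u , v) = trans (entry-positionAt u _ _) (cong (u ,_) (fromDigits-remQuot v))

    entry-↔ : ((Fin k ⊎ Fin k) × (Fin k ⊎ Fin k)) ↔ Γ γ
    entry-↔ = mk↔ₛ′ (uncurry entry) position entry-position (uncurry position-entry)

    M : Fin (k + k) → Fin (k + k) → Γ γ
    M i j = entry (splitAt k i) (splitAt k j)

    M-↔ : (Fin (k + k) × Fin (k + k)) ↔ Γ γ
    M-↔ = entry-↔ ↔-∘ (+↔⊎ ×-↔ +↔⊎)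

    T : ℕ
    T = k * (k ∸ 1)

    μ : Γ γ
    μ = 0F , T mod 2 ^ (2 * γ)

    lineSum≡μ : (h : Fin k ⊎ Fin k → Γ γ) {c d : Fin 4} →
                (∀ a → proj₁ (h (inj₁ a)) ≡ c) → (∀ a → proj₁ (h (inj₂ a)) ≡ d) → (s : ℕ) →
                ∑[ a < k ] toℕ (proj₂ (h (inj₁ a))) + ∑[ a < k ] toℕ (proj₂ (h (inj₂ a))) ≡ T + s * (k * k) →
                sumΓ γ (k + k) (h ∘ splitAt k) ≡ μ
    lineSum≡μ h {c} {d} h₁≡c h₂≡d s second-sum =
      trans (sumΓ-mod (k + k) (h ∘ splitAt k)) (cong₂ _,_ Σ₁-mod Σ₂-mod)
      where
      Σ₁ Σ₂ : ℕ
      Σ₁ = ∑[ i < k + k ] toℕ (proj₁ (h (splitAt k i)))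
      Σ₂ = ∑[ i < k + k ] toℕ (proj₂ (h (splitAt k i)))

      Σ₁≡k*[c+d] : Σ₁ ≡ k * (toℕ c + toℕ d)
      Σ₁≡k*[c+d] = begin
        Σ₁                                    ≡⟨ ∑-splitAt k (toℕ ∘ proj₁ ∘ h) ⟩
        ∑[ a < k ] toℕ (proj₁ (h (inj₁ a))) + ∑[ a < k ] toℕ (proj₁ (h (inj₂ a)))
          ≡⟨ cong₂ _+_ (sum-cong-≗ {k} (cong toℕ ∘ h₁≡c)) (sum-cong-≗ {k} (cong toℕ ∘ h₂≡d)) ⟩
        ∑[ a < k ] toℕ c + ∑[ a < k ] toℕ d   ≡⟨ cong₂ _+_ (∑-const k (toℕ c)) (∑-const k (toℕ d)) ⟩
        k * toℕ c + k * toℕ d                 ≡⟨ ℕ.*-distribˡ-+ k (toℕ c) (toℕ d) ⟨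
        k * (toℕ c + toℕ d)                   ∎

      Σ₁-mod : Σ₁ mod 4 ≡ 0F
      Σ₁-mod = mod-cong 4 Σ₁ 0 $ n∣m⇒m%n≡0 Σ₁ 4 $
        subst (4 ∣_) (sym Σ₁≡k*[c+d]) (∣-trans 4∣k (m∣m*n (toℕ c + toℕ d)))

      Σ₂-mod : Σ₂ mod 2 ^ (2 * γ) ≡ T mod 2 ^ (2 * γ)
      Σ₂-mod = mod-cong _ Σ₂ T $ begin
        Σ₂ % 2 ^ (2 * γ)                      ≡⟨ cong (_% 2 ^ (2 * γ)) (∑-splitAt k (toℕ ∘ proj₂ ∘ h)) ⟩
        (∑[ a < k ] toℕ (proj₂ (h (inj₁ a))) + ∑[ a < k ] toℕ (proj₂ (h (inj₂ a)))) % 2 ^ (2 * γ)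
                                              ≡⟨ cong (_% 2 ^ (2 * γ)) second-sum ⟩
        (T + s * (k * k)) % 2 ^ (2 * γ)       ≡⟨ cong (λ n → (T + s * n) % 2 ^ (2 * γ)) 2^[2γ]≡k*k ⟨
        (T + s * 2 ^ (2 * γ)) % 2 ^ (2 * γ)   ≡⟨ [m+kn]%n≡m%n T s _ ⟩
        T % 2 ^ (2 * γ)                       ∎

    Σ⟨_⟩ : (Fin k → Fin k) → ℕ
    Σ⟨ X ⟩ = ∑[ a < k ] toℕ (X a)

    digitSum : (Fin k → Fin k) → (Fin k → Fin k) → ℕ
    digitSum X Y = ∑[ a < k ] toℕ (fromDigits (X a) (Y a))

    digitSum≡ : ∀ X Y → digitSum X Y ≡ k * Σ⟨ X ⟩ + Σ⟨ Y ⟩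
    digitSum≡ X Y = begin
      digitSum X Y                             ≡⟨ sum-cong-≗ {k} (λ a → toℕ-fromDigits (X a) (Y a)) ⟩
      ∑[ a < k ] (k * toℕ (X a) + toℕ (Y a))   ≡⟨ ∑-distrib-+ {k} _ _ ⟩
      ∑[ a < k ] (k * toℕ (X a)) + Σ⟨ Y ⟩      ≡⟨ cong (_+ Σ⟨ Y ⟩) (*-distribˡ-sum k (toℕ ∘ X)) ⟨
      k * Σ⟨ X ⟩ + Σ⟨ Y ⟩                       ∎

    digitSum+digitSum : ∀ X Y Z → digitSum X Y + digitSum X Z ≡ k * (2 * Σ⟨ X ⟩) + (Σ⟨ Y ⟩ + Σ⟨ Z ⟩)
    digitSum+digitSum X Y Z =
      trans (cong₂ _+_ (digitSum≡ X Y) (digitSum≡ X Z)) (regroup k Σ⟨ X ⟩ Σ⟨ Y ⟩ Σ⟨ Z ⟩)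
      where
      regroup : ∀ k x y z → (k * x + y) + (k * x + z) ≡ k * (2 * x) + (y + z)
      regroup = solve-∀

    digitSum+digitSum≡T+[k∸1]k² : ∀ X Y Z → 2 * Σ⟨ X ⟩ ≡ T → Σ⟨ Y ⟩ + Σ⟨ Z ⟩ ≡ T →
                                  digitSum X Y + digitSum X Z ≡ T + (k ∸ 1) * (k * k)
    digitSum+digitSum≡T+[k∸1]k² X Y Z 2ΣX≡T ΣY+ΣZ≡T = begin
      digitSum X Y + digitSum X Z              ≡⟨ digitSum+digitSum X Y Z ⟩
      k * (2 * Σ⟨ X ⟩) + (Σ⟨ Y ⟩ + Σ⟨ Z ⟩)      ≡⟨ cong₂ (λ u v → k * u + v) 2ΣX≡T ΣY+ΣZ≡T ⟩
      k * T + T                                ≡⟨ regroup k (k ∸ 1) ⟩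
      T + (k ∸ 1) * (k * k)                    ∎
      where
      regroup : ∀ k l → k * (k * l) + k * l ≡ k * l + l * (k * k)
      regroup = solve-∀

    digitSum+digitSum≡T+[2b]k² : ∀ b Y → 2 * Σ⟨ Y ⟩ ≡ T →
                                 digitSum (const b) Y + digitSum (const b) Y ≡ T + (2 * toℕ b) * (k * k)
    digitSum+digitSum≡T+[2b]k² b Y 2ΣY≡T = begin
      digitSum (const b) Y + digitSum (const b) Y  ≡⟨ digitSum+digitSum (const b) Y Y ⟩
      k * (2 * Σ⟨ const b ⟩) + (Σ⟨ Y ⟩ + Σ⟨ Y ⟩)
        ≡⟨ cong₂ (λ u v → k * (2 * u) + (Σ⟨ Y ⟩ + v)) (∑-const k (toℕ b)) (sym (ℕ.+-identityʳ Σ⟨ Y ⟩)) ⟩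
      k * (2 * (k * toℕ b)) + 2 * Σ⟨ Y ⟩            ≡⟨ cong (k * (2 * (k * toℕ b)) +_) 2ΣY≡T ⟩
      k * (2 * (k * toℕ b)) + T                    ≡⟨ regroup k (toℕ b) T ⟩
      T + (2 * toℕ b) * (k * k)                    ∎
      where
      regroup : ∀ k b t → k * (2 * (k * b)) + t ≡ t + (2 * b) * (k * k)
      regroup = solve-∀

    2*Σ-id : 2 * Σ⟨ id ⟩ ≡ T
    2*Σ-id = 2*∑-toℕ k

    2*Σ-opposite : 2 * Σ⟨ opposite ⟩ ≡ T
    2*Σ-opposite = trans (cong (2 *_) (∑-opposite k toℕ)) (2*∑-toℕ k)

    Σ-id+Σ-opposite : Σ⟨ id ⟩ + Σ⟨ opposite ⟩ ≡ T
    Σ-id+Σ-opposite = ∑-toℕ+∑-toℕ-opposite k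

    Σ-const+Σ-const-opposite : ∀ a → Σ⟨ const a ⟩ + Σ⟨ const (opposite a) ⟩ ≡ T
    Σ-const+Σ-const-opposite a = begin
      Σ⟨ const a ⟩ + Σ⟨ const (opposite a) ⟩
        ≡⟨ cong₂ _+_ (∑-const k (toℕ a)) (∑-const k (toℕ (opposite a))) ⟩
      k * toℕ a + k * toℕ (opposite a)         ≡⟨ ℕ.*-distribˡ-+ k (toℕ a) _ ⟨
      k * (toℕ a + toℕ (opposite a))           ≡⟨ cong (k *_) (toℕ+toℕ-opposite a) ⟩
      T                                        ∎

    rowSum : ∀ x → sumΓ γ (k + k) (entry x ∘ splitAt k) ≡ μ
    rowSum (inj₁ a) = lineSum≡μ (entry (inj₁ a)) (λ _ → refl) (λ _ → refl) (k ∸ 1)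
      (digitSum+digitSum≡T+[k∸1]k² id (const a) (const (opposite a)) 2*Σ-id (Σ-const+Σ-const-opposite a))
    rowSum (inj₂ a) = lineSum≡μ (entry (inj₂ a)) (λ _ → refl) (λ _ → refl) (k ∸ 1)
      (digitSum+digitSum≡T+[k∸1]k² id (const a) (const (opposite a)) 2*Σ-id (Σ-const+Σ-const-opposite a))

    columnSum : ∀ y → sumΓ γ (k + k) (λ i → entry (splitAt k i) y) ≡ μ
    columnSum (inj₁ b) = lineSum≡μ (λ x → entry x (inj₁ b)) (λ _ → refl) (λ _ → refl) (2 * toℕ b)
      (digitSum+digitSum≡T+[2b]k² b id 2*Σ-id)
    columnSum (inj₂ b) = lineSum≡μ (λ x → entry x (inj₂ b)) (λ _ → refl) (λ _ → refl) (2 * toℕ b)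
      (digitSum+digitSum≡T+[2b]k² b opposite 2*Σ-opposite)

    diagonalSum : sumΓ γ (k + k) (λ i → M i i) ≡ μ
    diagonalSum = lineSum≡μ (λ x → entry x x) (λ _ → refl) (λ _ → refl) (k ∸ 1)
      (digitSum+digitSum≡T+[k∸1]k² id id opposite 2*Σ-id Σ-id+Σ-opposite)

    antidiagonalSum : sumΓ γ (k + k) (λ i → M i (opposite i)) ≡ μ
    antidiagonalSum =
      trans (sumΓ-cong (k + k) (λ i → cong (entry (splitAt k i)) (splitAt-opposite k i)))
            (lineSum≡μ (λ x → entry x (swap (⊎-map opposite opposite x))) (λ _ → refl) (λ _ → refl) (k ∸ 1)
              (digitSum+digitSum≡T+[k∸1]k² opposite opposite id 2*Σ-opposite
                (trans (ℕ.+-comm Σ⟨ opposite ⟩ _) Σ-id+Σ-opposite)))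

    square : MagicSquare γ (k + k)
    square = record
      { M        = M
      ; bij      = ↔⇒⤖ M-↔
      ; bij-is-M = λ _ → refl
      ; μ        = μ
      ; rows     = rowSum ∘ splitAt k
      ; cols     = columnSum ∘ splitAt k
      ; diag     = diagonalSum
      ; antidiag = antidiagonalSum
      }

2^[2n]≡2^n*2^n : ∀ n → 2 ^ (2 * n) ≡ 2 ^ n * 2 ^ n
2^[2n]≡2^n*2^n n = trans (cong (λ m → 2 ^ (n + m)) (ℕ.+-identityʳ n)) (ℕ.^-distribˡ-+-* 2 n n)

2^[n+1]≡2^n+2^n : ∀ n → 2 ^ (n + 1) ≡ 2 ^ n + 2 ^ n
2^[n+1]≡2^n+2^n n = trans (cong (2 ^_) (ℕ.+-comm n 1)) (cong (2 ^ n +_) (ℕ.+-identityʳ (2 ^ n)))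

4∣2^n : ∀ {n} → 2 ≤ n → 4 ∣ 2 ^ n
4∣2^n {1}           (s≤s ())
4∣2^n {suc (suc n)} _        = subst (4 ∣_) (sym (ℕ.^-distribˡ-+-* 2 2 n)) (m∣m*n (2 ^ n))

mainTheorem10 : (γ : ℕ) → 2 ≤ γ → MagicSquare γ (2 ^ (γ + 1))
mainTheorem10 γ 2≤γ = subst (MagicSquare γ) (sym (2^[n+1]≡2^n+2^n γ))
  (Construction.square γ (2 ^ γ) (2^[2n]≡2^n*2^n γ) (4∣2^n 2≤γ))
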